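{- Let $\vec c$ be a composition of $n$ and let $\pi=\{B_1,\dots,B_{m-1},\underline{B_m}\}\in\Pi^{\bullet}_{\vec c}$ with $m\ge 2$. Let $\Omega$ be the subcomplex of $\Delta_{\vec c}$ consisting of the faces $\tau$ with $\phi(\tau)\in(\Pi^{\bullet}_{\vec c}-\{\hat 1\})_{\ge\pi}$. Then $\Omega$ is a cone with apex $([n]\setminus B_m,\,B_m)$, and hence is contractible.
   Context: A pointed set partition of $[n]$ is $\{B_1,\dots,B_k,\underline Z\}$ where $Z\subseteq[n]$ (possibly empty, the pointed block) and $B_1,\dots,B_k$ are nonempty blocks partitioning $[n]\setminus Z$. $\Pi^\bullet_n$ is the poset of these with $\pi\le\pi'$ iff each non-pointed block of $\pi$ lies in some block of $\pi'$ and the pointed block of $\pi$ lies in the pointed block of $\pi'$. Its type is the multiset $\{|B_1|,\dots,|B_k|\}$ together with the distinguished (pointed) number $|Z|$. A pointed composition of $n$ is $(c_1,\dots,c_k)$ with $c_1,\dots,c_{k-1}\ge1$, $c_k\ge0$, sum $n$; a composition if $c_k>0$; ordered by $\vec c\le\vec d$ iff $\vec d$ is obtained from $\vec c$ by replacing runs of consecutive entries by their sums; its type is the multiset $\{c_1,\dots,c_{k-1}\}$ with pointed number $c_k$. $\Pi^\bullet_{\vec c}$ is the induced subposet of $\Pi^\bullet_n$ of all $\pi$ with $\operatorname{type}(\pi)=\operatorname{type}(\vec d)$ for some $\vec d\ge\vec c$; its maximum $\hat 1$ is $\{\underline{[n]}\}$, and $P_{\ge\pi}$ denotes $\{x\in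 P:x\ge\pi\}$. An ordered set partition of $[n]$ is $(C_1,\dots,C_r)$, pairwise disjoint with union $[n]$, $C_1,\dots,C_{r-1}$ nonempty, $C_r$ possibly empty; type $(|C_1|,\dots,|C_r|)$. $\Delta_n$ is the simplicial complex with these faces ($(C_1,\dots,C_r)$ of dimension $r-2$, faces obtained by merging consecutive blocks, $([n])$ the empty face), and $\Delta_{\vec c}=\{\tau\in\Delta_n:\vec c\le\operatorname{type}(\tau)\}$. The forgetful map $\phi$ sends $(C_1,\dots,C_r)$ to $\{C_1,\dots,C_{r-1},\underline{C_r}\}$. -}

module Defs where

open import Data.Nat using (ℕ; zero; suc; _≤_; _<_)
open import Data.Fin using (Fin)
open import Data.Fin.Subset using (Subset; _∈_; _∉_; _⊆_; _∩_; ∁; ⊤; ⋃; ∣_∣; Nonempty; Empty)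
open import Data.List using (List; []; _∷_; _++_; [_]; map; length)
open import Data.Nat.ListAction using (sum)
open import Data.List.Relation.Unary.All using (All)
open import Data.List.Relation.Unary.Any using (Any)
open import Data.List.Relation.Unary.AllPairs using (AllPairs)
open import Data.List.Relation.Binary.Permutation.Propositional using (_↭_)
open import Data.Product using (Σ; ∃; ∃₂; _×_; _,_)
open import Data.Sum using (_⊎_)
open import Relation.Binary.PropositionalEquality using (_≡_; _≢_)
open import Relation.Nullary using (¬_)

-- Merging runs of consecutive entries.
-- `Coarsening f xs ys` : ys is obtained from xs by cutting xs into
-- consecutive nonempty runs and replacing each run r by f r.

data Coarsening {A : Set} (f : List A → A) : List A → List A → Set where
  done : Coarsening f [] []
  run  : ∀ (x : A) (xs ys zs : List A) →
         Coarsening f ys zs →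
         Coarsening f ((x ∷ xs) ++ ys) (f (x ∷ xs) ∷ zs)

-- A pointed composition is a nonempty list of
-- naturals, all entries but the last ≥ 1.  The order c ≤ d means d is
-- obtained from c by merging runs of consecutive entries.

_≤pc_ : List ℕ → List ℕ → Set
c ≤pc d = Coarsening sum c d

IsComposition : ℕ → List ℕ → Set
IsComposition n c = (c ≢ []) × All (λ x → 1 ≤ x) c × (sum c ≡ n)

-- Pointed set partitions of [n] = Fin n.
-- `blocks` are the non-pointed blocks (the order of the list is
-- irrelevant: all notions below are invariant under permuting it),
-- `pointed` is the pointed block Z (possibly empty).

record PointedPartition (n : ℕ) : Set where
  constructor ppart
  field
    blocks  : List (Subset n)
    pointed : Subset n
open PointedPartition public

Disjoint : ∀ {n} → Subset n → Subset n → Set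
Disjoint p q = Empty (p ∩ q)

IsPointedPartition : ∀ {n} → PointedPartition n → Set
IsPointedPartition {n} π =
  All Nonempty (blocks π) ×
  AllPairs Disjoint (pointed π ∷ blocks π) ×
  (∀ (x : Fin n) → x ∈ pointed π ⊎ Any (x ∈_) (blocks π))

_≤pp_ : ∀ {n} → PointedPartition n → PointedPartition n → Set
π ≤pp π' =
  All (λ B → pointed π' ⊇' B ⊎ Any (λ B' → B ⊆ B') (blocks π')) (blocks π) ×
  (pointed π ⊆ pointed π')
  where
  _⊇'_ : _ → _ → Set
  X ⊇' Y = Y ⊆ X

IsTop : ∀ {n} → PointedPartition n → Set
IsTop π = (blocks π ≡ []) × (pointed π ≡ ⊤)

TypeEq : ∀ {n} → PointedPartition n → List ℕ → Set
TypeEq π d = ∃₂ λ (ds : List ℕ) (dk : ℕ) →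
  (d ≡ ds ++ [ dk ]) × (map ∣_∣ (blocks π) ↭ ds) × (∣ pointed π ∣ ≡ dk)

InΠ : ∀ {n} → List ℕ → PointedPartition n → Set
InΠ c π = IsPointedPartition π × ∃ λ d → (c ≤pc d) × TypeEq π d

-- Ordered set partitions (C_1,…,C_r) of [n]: front = (C_1,…,C_{r-1})
-- (nonempty blocks), back = C_r (possibly empty).

record OrderedPartition (n : ℕ) : Set where
  constructor opart
  field
    front : List (Subset n)
    back  : Subset n
open OrderedPartition public

blocksOf : ∀ {n} → OrderedPartition n → List (Subset n)
blocksOf τ = front τ ++ [ back τ ]

IsOrderedPartition : ∀ {n} → OrderedPartition n → Set
IsOrderedPartition {n} τ =
  All Nonempty (front τ) ×
  AllPairs Disjoint (blocksOf τ) ×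
  (∀ (x : Fin n) → Any (x ∈_) (blocksOf τ))

otype : ∀ {n} → OrderedPartition n → List ℕ
otype τ = map ∣_∣ (blocksOf τ)

_≤face_ : ∀ {n} → OrderedPartition n → OrderedPartition n → Set
σ ≤face τ = Coarsening ⋃ (blocksOf τ) (blocksOf σ)

IsVertex : ∀ {n} → OrderedPartition n → Set
IsVertex τ = IsOrderedPartition τ × (length (front τ) ≡ 1)

InΔ : ∀ {n} → List ℕ → OrderedPartition n → Set
InΔ c τ = IsOrderedPartition τ × (c ≤pc otype τ)

φ : ∀ {n} → OrderedPartition n → PointedPartition n
φ τ = ppart (front τ) (back τ)

InΩ : ∀ {n} → List ℕ → PointedPartition n → OrderedPartition n → Set
InΩ c π τ = InΔ c τ × InΠ c (φ τ) × ¬ IsTop (φ τ) × (π ≤pp φ τ)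

apex : ∀ {n} → PointedPartition n → OrderedPartition n
apex π = opart [ ∁ (pointed π) ] (pointed π)

-- Ω is a cone with apex v: v ∈ Ω, and for every face τ ∈ Ω the face
-- τ ∪ {v} (the face ρ whose vertex set is vert(τ) ∪ {v}) exists and lies in Ω.
IsConeWithApex : ∀ {n} → (OrderedPartition n → Set) → OrderedPartition n → Set
IsConeWithApex {n} Ω v =
  Ω v ×
  (∀ (τ : OrderedPartition n) → Ω τ →
     Σ (OrderedPartition n) λ ρ →
       Ω ρ × (v ≤face ρ) × (τ ≤face ρ) ×
       (∀ (w : OrderedPartition n) → IsVertex w → w ≤face ρ →
          (w ≡ v) ⊎ (w ≤face τ)))

module Submission where

-- Let τ = (F, C) ∈ Ω, with F = (C₁,…,C_{r-1}).  Since π ≤ φ(τ), Z ⊆ C; put D = C ∖ Z.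
--   * If D = ∅ then C = Z, so the apex (⋃F, C) is already a vertex of τ, and τ is its own cone face.
--   * Otherwise the cone face is ρ = (F, D, Z), obtained from τ by splitting its last block.
--     Its type (…, |D|, |Z|) still coarsens c, because c ≤ type(π) already has a cut
--     before a final run summing to |Z|; φ(ρ) lies above π and below 1̂.  A vertex of ρ is a
--     cut (⋃P, ⋃S) of its block list: either S = (Z), which is the apex, or S ⊇ (D, Z), and
--     then merging D and Z back shows that it is a vertex of τ.
-- The apex lies in Ω since m ≥ 2 makes [n] ∖ Z nonempty and c has a cut before its final run |Z|.

open import Defs
open import Data.Nat using (ℕ; suc; z≤n; s≤s; _≤_; _<_; _+_)
open import Data.Nat.Properties using (≤-trans; ≤-reflexive; <-irrefl; <⇒≱; +-suc; +-monoˡ-≤; +-cancelʳ-≡; m≤n+m; m∸n+n≡m; module ≤-Reasoning)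
open import Data.Nat.ListAction using (sum)
open import Data.Nat.ListAction.Properties using (sum-++)
open import Data.Fin using (Fin)
open import Data.Fin.Subset using (Subset; _∈_; _∉_; _⊆_; _∪_; _─_; ∁; ⋃; ∣_∣; Nonempty; Empty; inside; outside)
open import Data.Fin.Subset.Properties using (x∈p∩q⁺; p∩q⊆p; p∩q⊆q; x∈p∪q⁺; x∈p∪q⁻; ∉⊥; ⊆⊤; ⊆-antisym; ∪-identityʳ; x∈p∧x∉q⇒x∈p─q; p─q⊆p; x∉p⇒x∈∁p; x∈∁p⇒x∉p; ∣∁p∣≡n∸∣p∣; ∣p∣≤n; ∣⁅x⁆∣≡1; x∈⁅y⁆⇒x≡y; p⊆q⇒∣p∣≤∣q∣; nonempty?; drop-∷-⊆; _∈?_)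
open import Data.Vec using ([]; _∷_; here; there)
open import Data.List using (List; []; _∷_; _++_; [_]; map; length)
open import Data.List.Properties using (++-assoc; ++-identityʳ; map-++; ∷-injective; ++-conicalʳ; length-map)
open import Data.List.Relation.Unary.All as All using (All; []; _∷_)
import Data.List.Relation.Unary.All.Properties as All
open import Data.List.Relation.Unary.Any using (Any; here; there)
import Data.List.Relation.Unary.Any.Properties as Any
open import Data.List.Relation.Unary.AllPairs using (AllPairs; []; _∷_)
import Data.List.Relation.Unary.AllPairs.Properties as AllPairs
open import Data.List.Relation.Binary.Permutation.Propositional using (_↭_; ↭-refl)
open import Data.List.Relation.Binary.Permutation.Propositional.Properties using (↭-length)
open import Data.Product using (Σ; ∃; ∃₂; _×_; _,_; proj₁; proj₂)
open import Data.Sum using (_⊎_; inj₁; inj₂)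
open import Data.Empty using (⊥-elim)
open import Function using (flip)
open import Relation.Binary.PropositionalEquality using (_≡_; refl; sym; trans; cong; cong₂; subst; subst₂; module ≡-Reasoning)
open import Relation.Nullary using (¬_; yes; no; contradiction)

module _ {A : Set} {f : List A → A} where

  coarsening-++ : ∀ {xs ys us vs} → Coarsening f xs ys → Coarsening f us vs →
                  Coarsening f (xs ++ us) (ys ++ vs)
  coarsening-++ done q = q
  coarsening-++ {us = us} {vs} (run x xs ys zs p) q =
    subst (λ L → Coarsening f L (f (x ∷ xs) ∷ zs ++ vs)) (sym (++-assoc (x ∷ xs) ys us))
      (run x xs (ys ++ us) (zs ++ vs) (coarsening-++ p q))

  coarsening-cut : (x : A) (xs : List A) (y : A) (ys : List A) →
                   Coarsening f ((x ∷ xs) ++ (y ∷ ys)) (f (x ∷ xs) ∷ f (y ∷ ys) ∷ [])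
  coarsening-cut x xs y ys =
    run x xs (y ∷ ys) _ (subst (λ L → Coarsening f L [ f (y ∷ ys) ]) (++-identityʳ (y ∷ ys)) (run y ys [] [] done))

  coarsening-cut-snoc : (x : A) (xs zs : List A) (z : A) →
    Coarsening f ((x ∷ xs) ++ (zs ++ [ z ])) (f (x ∷ xs) ∷ f (zs ++ [ z ]) ∷ [])
  coarsening-cut-snoc x xs []       z = coarsening-cut x xs z []
  coarsening-cut-snoc x xs (y ∷ ys) z = coarsening-cut x xs y (ys ++ [ z ])

  coarsening-refl : (∀ x → f [ x ] ≡ x) → (xs : List A) → Coarsening f xs xs
  coarsening-refl f[x]≡x []       = done
  coarsening-refl f[x]≡x (x ∷ xs) =
    subst (λ y → Coarsening f (x ∷ xs) (y ∷ xs)) (f[x]≡x x) (run x [] xs xs (coarsening-refl f[x]≡x xs))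

  coarsening-snoc⁻ : ∀ (M : List A) {m L} → Coarsening f L (M ++ [ m ]) →
    ∃₂ λ L₁ y → ∃ λ ys → (L ≡ L₁ ++ (y ∷ ys)) × Coarsening f L₁ M × (m ≡ f (y ∷ ys))
  coarsening-snoc⁻ []      (run x xs .[] .[] done) = [] , x , xs , ++-identityʳ _ , done , refl
  coarsening-snoc⁻ (_ ∷ M) (run x xs ys .(M ++ _) p) with coarsening-snoc⁻ M p
  ... | L₁ , y , ys′ , ys≡ , q , m≡ =
    (x ∷ xs) ++ L₁ , y , ys′ ,
    trans (cong ((x ∷ xs) ++_) ys≡) (sym (++-assoc (x ∷ xs) L₁ (y ∷ ys′))) ,
    run x xs L₁ M q , m≡

  coarsening-cut⁻ : ∀ {L a b} → Coarsening f L (a ∷ b ∷ []) →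
    ∃₂ λ x xs → ∃₂ λ y ys → (L ≡ (x ∷ xs) ++ (y ∷ ys)) × (a ≡ f (x ∷ xs)) × (b ≡ f (y ∷ ys))
  coarsening-cut⁻ (run x xs .(_ ++ []) .(_ ∷ []) (run y ys .[] .[] done)) =
    x , xs , y , ys , cong ((x ∷ xs) ++_) (++-identityʳ _) , refl , refl

cut-before-last-two : ∀ {A : Set} {a b : A} (P us : List A) (y : A) (ys : List A) →
  P ++ a ∷ b ∷ [] ≡ us ++ y ∷ ys →
  ((us ≡ P ++ [ a ]) × (y ∷ ys ≡ [ b ])) ⊎ (∃ λ zs → (y ∷ ys ≡ zs ++ a ∷ b ∷ []) × (P ≡ us ++ zs))
cut-before-last-two P       []                y ys eq   = inj₂ (P , sym eq , refl)
cut-before-last-two []      (u ∷ [])          y ys refl = inj₁ (refl , refl)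
cut-before-last-two []      (u ∷ u′ ∷ us)     y ys eq
  with ++-conicalʳ us (y ∷ ys) (sym (proj₂ (∷-injective (proj₂ (∷-injective eq)))))
... | ()
cut-before-last-two (p ∷ P) (u ∷ us)          y ys eq with ∷-injective eq
... | refl , eq′ with cut-before-last-two P us y ys eq′
...   | inj₁ (us≡ , ys≡)     = inj₁ (cong (p ∷_) us≡ , ys≡)
...   | inj₂ (zs , ys≡ , P≡) = inj₂ (zs , ys≡ , cong (p ∷_) P≡)

lighter-suffix : (xs ys us vs : List ℕ) → xs ++ ys ≡ us ++ vs → sum vs < sum ys →
  ∃₂ λ g gs → ys ≡ (g ∷ gs) ++ vs
lighter-suffix []       ys []       .ys  refl lt = ⊥-elim (<-irrefl refl lt)
lighter-suffix []       ys (u ∷ us) vs   eq   lt = u , us , eq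
lighter-suffix (x ∷ xs) ys []       .(x ∷ xs ++ ys) refl lt = ⊥-elim (<⇒≱ lt ys≤)
  where
  open ≤-Reasoning
  ys≤ : sum ys ≤ sum ((x ∷ xs) ++ ys)
  ys≤ = begin
    sum ys                 ≤⟨ m≤n+m (sum ys) (sum (x ∷ xs)) ⟩
    sum (x ∷ xs) + sum ys  ≡⟨ sum-++ (x ∷ xs) ys ⟨
    sum ((x ∷ xs) ++ ys)   ∎
lighter-suffix (x ∷ xs) ys (u ∷ us) vs   eq   lt = lighter-suffix xs ys us vs (proj₂ (∷-injective eq)) lt

split-last-entry : (c T ds : List ℕ) (t s z : ℕ) → c ≤pc (T ++ [ t ]) → c ≤pc (ds ++ [ z ]) →
  t ≡ s + z → 1 ≤ s → c ≤pc (T ++ s ∷ z ∷ [])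
split-last-entry c T ds t s z c≤T c≤ds t≡s+z 1≤s
  with coarsening-snoc⁻ T c≤T | coarsening-snoc⁻ ds c≤ds
... | L , y , ys , c≡L++ , L≤T , t≡ | L′ , y′ , ys′ , c≡L′++ , _ , z≡
  with lighter-suffix L (y ∷ ys) L′ (y′ ∷ ys′) (trans (sym c≡L++) c≡L′++) lighter
  where
  lighter : sum (y′ ∷ ys′) < sum (y ∷ ys)
  lighter = subst₂ _<_ z≡ (trans (sym t≡s+z) t≡) (+-monoˡ-≤ z 1≤s)
... | g , gs , ys≡ =
  subst₂ (Coarsening sum) (sym (trans c≡L++ (cong (L ++_) ys≡)))
    (cong₂ (λ u v → T ++ u ∷ v ∷ []) sum≡s (sym z≡))
    (coarsening-++ L≤T (coarsening-cut g gs y′ ys′))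
  where
  open ≡-Reasoning
  sum≡s : sum (g ∷ gs) ≡ s
  sum≡s = +-cancelʳ-≡ z _ _ (begin
     sum (g ∷ gs) + z                   ≡⟨ cong (sum (g ∷ gs) +_) z≡ ⟩
     sum (g ∷ gs) + sum (y′ ∷ ys′)      ≡⟨ sum-++ (g ∷ gs) (y′ ∷ ys′) ⟨
     sum ((g ∷ gs) ++ (y′ ∷ ys′))       ≡⟨ cong sum ys≡ ⟨
     sum (y ∷ ys)                       ≡⟨ t≡ ⟨
     t                                  ≡⟨ t≡s+z ⟩
     s + z                              ∎)

coarsening-into-two : (c ds : List ℕ) {s z : ℕ} → 1 ≤ length ds → c ≤pc (ds ++ [ z ]) →
  s + z ≡ sum c → c ≤pc (s ∷ z ∷ [])
coarsening-into-two c (d ∷ ds) {s} {z} _ c≤ds s+z≡ with coarsening-snoc⁻ (d ∷ ds) c≤ds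
... | x ∷ xs , y , ys , refl , _ , z≡ =
  subst₂ (λ u v → Coarsening sum c (u ∷ v ∷ [])) sum≡s (sym z≡) (coarsening-cut x xs y ys)
  where
  open ≡-Reasoning
  sum≡s : sum (x ∷ xs) ≡ s
  sum≡s = +-cancelʳ-≡ z _ _ (begin
    sum (x ∷ xs) + z               ≡⟨ cong (sum (x ∷ xs) +_) z≡ ⟩
    sum (x ∷ xs) + sum (y ∷ ys)    ≡⟨ sum-++ (x ∷ xs) (y ∷ ys) ⟨
    sum c                          ≡⟨ s+z≡ ⟨
    s + z                          ∎)

module _ {n : ℕ} where

  ∈⋃⁻ : ∀ {x : Fin n} (ps : List (Subset n)) → x ∈ ⋃ ps → Any (x ∈_) ps
  ∈⋃⁻ []       x∈ = contradiction x∈ ∉⊥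
  ∈⋃⁻ (p ∷ ps) x∈ with x∈p∪q⁻ p (⋃ ps) x∈
  ... | inj₁ x∈p  = here x∈p
  ... | inj₂ x∈ps = there (∈⋃⁻ ps x∈ps)

  ∈⋃⁺ : ∀ {x : Fin n} {ps : List (Subset n)} → Any (x ∈_) ps → x ∈ ⋃ ps
  ∈⋃⁺ (here x∈p)   = x∈p∪q⁺ (inj₁ x∈p)
  ∈⋃⁺ (there x∈ps) = x∈p∪q⁺ (inj₂ (∈⋃⁺ x∈ps))

  ⋃-singleton : (p : Subset n) → ⋃ [ p ] ≡ p
  ⋃-singleton = ∪-identityʳ

  ⋃-++ˡ : (zs : List (Subset n)) {L L′ : List (Subset n)} → ⋃ L ≡ ⋃ L′ → ⋃ (zs ++ L) ≡ ⋃ (zs ++ L′)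
  ⋃-++ˡ []       eq = eq
  ⋃-++ˡ (z ∷ zs) eq = cong (z ∪_) (⋃-++ˡ zs eq)

  disjoint⇒∉ : ∀ {p q : Subset n} {x} → Disjoint p q → x ∈ p → x ∉ q
  disjoint⇒∉ d x∈p x∈q = d (_ , x∈p∩q⁺ (x∈p , x∈q))

  ∉⇒disjoint : ∀ {p q : Subset n} → (∀ {x} → x ∈ p → x ∉ q) → Disjoint p q
  ∉⇒disjoint {p} {q} ∉q (x , x∈p∩q) = ∉q (p∩q⊆p p q x∈p∩q) (p∩q⊆q p q x∈p∩q)

  disjoint-sym : ∀ {p q : Subset n} → Disjoint p q → Disjoint q p
  disjoint-sym d = ∉⇒disjoint (flip (disjoint⇒∉ d))

  disjoint-⊆ʳ : ∀ {p q r : Subset n} → r ⊆ q → Disjoint p q → Disjoint p r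
  disjoint-⊆ʳ r⊆q d = ∉⇒disjoint (λ x∈p x∈r → disjoint⇒∉ d x∈p (r⊆q x∈r))

  disjoint⇒⊆∁ : ∀ {p q : Subset n} → Disjoint q p → p ⊆ ∁ q
  disjoint⇒⊆∁ d x∈p = x∉p⇒x∈∁p (disjoint⇒∉ (disjoint-sym d) x∈p)

  nonempty⇒1≤∣p∣ : ∀ {p : Subset n} → Nonempty p → 1 ≤ ∣ p ∣
  nonempty⇒1≤∣p∣ {p} (x , x∈p) = ≤-trans (≤-reflexive (sym (∣⁅x⁆∣≡1 x)))
     (p⊆q⇒∣p∣≤∣q∣ (λ {y} y∈⁅x⁆ → subst (_∈ p) (sym (x∈⁅y⁆⇒x≡y x y∈⁅x⁆)) x∈p))

  ∣∁p∣+∣p∣≡n : (p : Subset n) → ∣ ∁ p ∣ + ∣ p ∣ ≡ n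
  ∣∁p∣+∣p∣≡n p = trans (cong (_+ ∣ p ∣) (∣∁p∣≡n∸∣p∣ p)) (m∸n+n≡m (∣p∣≤n p))

  ⋃-─-split : ∀ {p q : Subset n} → q ⊆ p → ⋃ ((p ─ q) ∷ q ∷ []) ≡ p
  ⋃-─-split {p} {q} q⊆p = ⊆-antisym ⊆p p⊆
    where
    ⊆p : ⋃ ((p ─ q) ∷ q ∷ []) ⊆ p
    ⊆p x∈ with ∈⋃⁻ ((p ─ q) ∷ q ∷ []) x∈
    ... | here x∈p─q      = p─q⊆p p q x∈p─q
    ... | there (here x∈q) = q⊆p x∈q
    p⊆ : p ⊆ ⋃ ((p ─ q) ∷ q ∷ [])
    p⊆ {x} x∈p with x ∈? q
    ... | yes x∈q = ∈⋃⁺ {ps = (p ─ q) ∷ q ∷ []} (there (here x∈q))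
    ... | no  x∉q = ∈⋃⁺ {ps = (p ─ q) ∷ q ∷ []} (here (x∈p∧x∉q⇒x∈p─q x∈p x∉q))

  empty-─⇒≡ : ∀ {p q : Subset n} → Empty (p ─ q) → q ⊆ p → p ≡ q
  empty-─⇒≡ {p} {q} empty q⊆p = ⊆-antisym p⊆q q⊆p
    where
    p⊆q : p ⊆ q
    p⊆q {x} x∈p with x ∈? q
    ... | yes x∈q = x∈q
    ... | no  x∉q = ⊥-elim (empty (x , x∈p∧x∉q⇒x∈p─q x∈p x∉q))

x∈p─q⇒x∉q : ∀ {n} {x : Fin n} (p q : Subset n) → x ∈ p ─ q → x ∉ q
x∈p─q⇒x∉q (_ ∷ p) (outside ∷ q) here        ()
x∈p─q⇒x∉q (_ ∷ p) (_       ∷ q) (there x∈) (there x∈q) = x∈p─q⇒x∉q p q x∈ x∈q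

∣p∣≡∣p─q∣+∣q∣ : ∀ {n} (p q : Subset n) → q ⊆ p → ∣ p ∣ ≡ ∣ p ─ q ∣ + ∣ q ∣
∣p∣≡∣p─q∣+∣q∣ []            []            _   = refl
∣p∣≡∣p─q∣+∣q∣ (inside ∷ p)  (inside ∷ q)  q⊆p = trans (cong suc (∣p∣≡∣p─q∣+∣q∣ p q (drop-∷-⊆ q⊆p))) (sym (+-suc _ _))
∣p∣≡∣p─q∣+∣q∣ (outside ∷ p) (inside ∷ q)  q⊆p with q⊆p here
... | ()
∣p∣≡∣p─q∣+∣q∣ (inside ∷ p)  (outside ∷ q) q⊆p = cong suc (∣p∣≡∣p─q∣+∣q∣ p q (drop-∷-⊆ q⊆p))
∣p∣≡∣p─q∣+∣q∣ (outside ∷ p) (outside ∷ q) q⊆p = ∣p∣≡∣p─q∣+∣q∣ p q (drop-∷-⊆ q⊆p)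

module _ {A : Set} where

  all-snoc⁻ : ∀ {P : A → Set} (F : List A) {C} → All P (F ++ [ C ]) → All P F × P C
  all-snoc⁻ F PFC with All.++⁻ F PFC
  ... | PF , PC ∷ [] = PF , PC

  any-snoc⁻ : ∀ {P : A → Set} (F : List A) {C} → Any P (F ++ [ C ]) → Any P F ⊎ P C
  any-snoc⁻ F PFC with Any.++⁻ F PFC
  ... | inj₁ PF        = inj₁ PF
  ... | inj₂ (here PC) = inj₂ PC

  allPairs-snoc⁻ : ∀ {R : A → A → Set} (F : List A) {C} → AllPairs R (F ++ [ C ]) →
    AllPairs R F × All (λ B → R B C) F
  allPairs-snoc⁻ []      _         = [] , []
  allPairs-snoc⁻ (B ∷ F) (RB ∷ RF) with all-snoc⁻ F RB | allPairs-snoc⁻ F RF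
  ... | RBF , RBC | RF′ , RFC = RBF ∷ RF′ , RBC ∷ RFC

  allPairs-replace-last : ∀ {R : A → A → Set} (F : List A) {C L} → AllPairs R (F ++ [ C ]) →
    (∀ {B} → R B C → All (R B) L) → AllPairs R L → AllPairs R (F ++ L)
  allPairs-replace-last F RFC toL RL with allPairs-snoc⁻ F RFC
  ... | RF , R-C = AllPairs.++⁺ RF RL (All.map toL R-C)

  any-replace-last : ∀ {P : A → Set} (F : List A) {C L} → Any P (F ++ [ C ]) →
    (P C → Any P L) → Any P (F ++ L)
  any-replace-last F PFC toL with any-snoc⁻ F PFC
  ... | inj₁ PF = Any.++⁺ˡ PF
  ... | inj₂ PC = Any.++⁺ʳ F (toL PC)

module _ {n : ℕ} where

  ⋃front≡∁back : ∀ {F : List (Subset n)} {C} → IsOrderedPartition (opart F C) → ⋃ F ≡ ∁ C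
  ⋃front≡∁back {F} {C} (_ , disjoint , cover) = ⊆-antisym ⋃F⊆∁C ∁C⊆⋃F
    where
    ⋃F⊆∁C : ⋃ F ⊆ ∁ C
    ⋃F⊆∁C x∈⋃F with All.lookupAny (proj₂ (allPairs-snoc⁻ F disjoint)) (∈⋃⁻ F x∈⋃F)
    ... | B∩C=∅ , x∈B = x∉p⇒x∈∁p (disjoint⇒∉ B∩C=∅ x∈B)
    ∁C⊆⋃F : ∁ C ⊆ ⋃ F
    ∁C⊆⋃F {x} x∈∁C with any-snoc⁻ F (cover x)
    ... | inj₁ x∈F = ∈⋃⁺ x∈F
    ... | inj₂ x∈C = contradiction x∈C (x∈∁p⇒x∉p x∈∁C)

  complement-vertex-face : ∀ {F : List (Subset n)} {C} → 1 ≤ length F → IsOrderedPartition (opart F C) →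
    opart [ ∁ C ] C ≤face opart F C
  complement-vertex-face {x ∷ xs} {C} _ τ-part =
    subst₂ (λ a b → Coarsening ⋃ ((x ∷ xs) ++ [ C ]) (a ∷ b ∷ []))
      (⋃front≡∁back τ-part) (⋃-singleton C) (coarsening-cut x xs C [])

  face-refl : (τ : OrderedPartition n) → τ ≤face τ
  face-refl τ = coarsening-refl ⋃-singleton (blocksOf τ)

  empty-front⇒top : ∀ {C : Subset n} → IsOrderedPartition (opart [] C) → IsTop (φ (opart [] C))
  empty-front⇒top {C} (_ , _ , cover) = refl , ⊆-antisym ⊆⊤ (λ {x} _ → in-C (cover x))
    where
    in-C : ∀ {x} → Any (x ∈_) [ C ] → x ∈ C
    in-C (here x∈C) = x∈C

  φ-partition : ∀ {τ : OrderedPartition n} → IsOrderedPartition τ → IsPointedPartition (φ τ)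
  φ-partition {opart F C} (nonempty , disjoint , cover) with allPairs-snoc⁻ F disjoint
  ... | F-disjoint , F∩C=∅ =
    nonempty , All.map disjoint-sym F∩C=∅ ∷ F-disjoint , λ x → swap (any-snoc⁻ F (cover x))
    where
    swap : ∀ {x} → Any (x ∈_) F ⊎ x ∈ C → x ∈ C ⊎ Any (x ∈_) F
    swap (inj₁ x∈F) = inj₂ x∈F
    swap (inj₂ x∈C) = inj₁ x∈C

  complement-pair : ∀ {Z : Subset n} → Nonempty (∁ Z) → IsOrderedPartition (opart [ ∁ Z ] Z)
  complement-pair {Z} ∁Z≠∅ = ∁Z≠∅ ∷ [] , (∉⇒disjoint x∈∁p⇒x∉p ∷ []) ∷ [] ∷ [] , cover
    where
    cover : ∀ x → Any (x ∈_) (∁ Z ∷ Z ∷ [])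
    cover x with x ∈? Z
    ... | yes x∈Z = there (here x∈Z)
    ... | no  x∉Z = here (x∉p⇒x∈∁p x∉Z)

φ-InΠ : ∀ {n} {c : List ℕ} {τ : OrderedPartition n} → InΔ c τ → InΠ c (φ τ)
φ-InΠ {τ = opart F C} (τ-part , c≤τ) =
  φ-partition τ-part , otype (opart F C) , c≤τ , map ∣_∣ F , ∣ C ∣ , map-++ ∣_∣ F [ C ] , ↭-refl , refl

InΩ-intro : ∀ {n} {c : List ℕ} {π : PointedPartition n} {τ : OrderedPartition n} →
  InΔ c τ → ¬ (front τ ≡ []) → π ≤pp φ τ → InΩ c π τ
InΩ-intro τ∈Δ front≢[] π≤φτ = τ∈Δ , φ-InΠ τ∈Δ , (λ top → front≢[] (proj₁ top)) , π≤φτ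

module Cone {n : ℕ} (c : List ℕ) (Bs : List (Subset n)) (Z : Subset n)
            (Z∩Bs=∅ : All (Disjoint Z) Bs) (ds : List ℕ) (c≤π : c ≤pc (ds ++ [ ∣ Z ∣ ])) where

  π : PointedPartition n
  π = ppart Bs Z

  split-off-Z : List (Subset n) → Subset n → OrderedPartition n
  split-off-Z F C = opart (F ++ [ C ─ Z ]) Z

  blocks-split : (F : List (Subset n)) (C : Subset n) → blocksOf (split-off-Z F C) ≡ F ++ (C ─ Z) ∷ Z ∷ []
  blocks-split F C = ++-assoc F [ C ─ Z ] [ Z ]

  split-ordered : ∀ {F C} → Z ⊆ C → Nonempty (C ─ Z) → IsOrderedPartition (opart F C) →
    IsOrderedPartition (split-off-Z F C)
  split-ordered {F} {C} Z⊆C C─Z≠∅ (nonempty , disjoint , cover) =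
    All.++⁺ nonempty (C─Z≠∅ ∷ []) ,
    subst (AllPairs Disjoint) (sym (blocks-split F C))
      (allPairs-replace-last F disjoint
        (λ B∩C=∅ → disjoint-⊆ʳ (p─q⊆p C Z) B∩C=∅ ∷ disjoint-⊆ʳ Z⊆C B∩C=∅ ∷ [])
        ((∉⇒disjoint (x∈p─q⇒x∉q C Z) ∷ []) ∷ [] ∷ [])) ,
    λ x → subst (Any (x ∈_)) (sym (blocks-split F C)) (any-replace-last F (cover x) split-member)
    where
    split-member : ∀ {x} → x ∈ C → Any (x ∈_) ((C ─ Z) ∷ Z ∷ [])
    split-member {x} x∈C with x ∈? Z
    ... | yes x∈Z = there (here x∈Z)
    ... | no  x∉Z = here (x∈p∧x∉q⇒x∈p─q x∈C x∉Z)

  split-type : ∀ {F C} → Z ⊆ C → Nonempty (C ─ Z) → c ≤pc otype (opart F C) →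
    c ≤pc otype (split-off-Z F C)
  split-type {F} {C} Z⊆C C─Z≠∅ c≤τ =
    subst (c ≤pc_) (sym otype-split)
      (split-last-entry c (map ∣_∣ F) ds (∣ C ∣) (∣ C ─ Z ∣) (∣ Z ∣)
        (subst (c ≤pc_) (map-++ ∣_∣ F [ C ]) c≤τ) c≤π
        (∣p∣≡∣p─q∣+∣q∣ C Z Z⊆C) (nonempty⇒1≤∣p∣ C─Z≠∅))
    where
    otype-split : otype (split-off-Z F C) ≡ map ∣_∣ F ++ ∣ C ─ Z ∣ ∷ ∣ Z ∣ ∷ []
    otype-split = trans (cong (map ∣_∣) (blocks-split F C)) (map-++ ∣_∣ F ((C ─ Z) ∷ Z ∷ []))

  -- A block of π inside C is disjoint from Z, hence inside C ∖ Z.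
  split-above-π : ∀ {F C} → π ≤pp φ (opart F C) → π ≤pp φ (split-off-Z F C)
  split-above-π {F} {C} (blocks≤ , _) = All.zipWith lift (Z∩Bs=∅ , blocks≤) , λ x∈Z → x∈Z
    where
    lift : ∀ {B} → Disjoint Z B × (B ⊆ C ⊎ Any (B ⊆_) F) → B ⊆ Z ⊎ Any (B ⊆_) (F ++ [ C ─ Z ])
    lift (Z∩B=∅ , inj₁ B⊆C) =
      inj₂ (Any.++⁺ʳ F (here (λ x∈B → x∈p∧x∉q⇒x∈p─q (B⊆C x∈B) (disjoint⇒∉ (disjoint-sym Z∩B=∅) x∈B))))
    lift (_ , inj₂ B⊆F) = inj₂ (Any.++⁺ˡ B⊆F)

  split-face : ∀ {F C} → Z ⊆ C → opart F C ≤face split-off-Z F C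
  split-face {F} {C} Z⊆C =
    subst₂ (Coarsening ⋃) (sym (blocks-split F C)) (cong (λ u → F ++ [ u ]) (⋃-─-split Z⊆C))
      (coarsening-++ (coarsening-refl ⋃-singleton F) (run (C ─ Z) [ Z ] [] [] done))

  split-vertices : ∀ {F C} → Z ⊆ C → IsOrderedPartition (split-off-Z F C) →
    ∀ (w : OrderedPartition n) → IsVertex w → w ≤face split-off-Z F C → (w ≡ apex π) ⊎ (w ≤face opart F C)
  split-vertices {F} {C} Z⊆C ρ-part (opart (a ∷ []) b) _ w≤ρ with coarsening-cut⁻ w≤ρ
  ... | x , xs , y , ys , blocks≡ , a≡ , b≡
    with cut-before-last-two F (x ∷ xs) y ys (trans (sym (blocks-split F C)) blocks≡)
  ... | inj₁ (P≡ , S≡) =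
    inj₁ (cong₂ (λ a′ b′ → opart [ a′ ] b′)
            (trans a≡ (trans (cong ⋃ P≡) (⋃front≡∁back ρ-part)))
            (trans b≡ (trans (cong ⋃ S≡) (⋃-singleton Z))))
  ... | inj₂ (zs , S≡ , F≡) =
    inj₂ (subst₂ (Coarsening ⋃)
            (trans (sym (++-assoc (x ∷ xs) zs [ C ])) (cong (_++ [ C ]) (sym F≡)))
            (cong₂ (λ u v → u ∷ v ∷ []) (sym a≡) merged)
            (coarsening-cut-snoc x xs zs C))
    where
    merged : ⋃ (zs ++ [ C ]) ≡ b
    merged = trans (⋃-++ˡ zs (trans (⋃-singleton C) (sym (⋃-─-split Z⊆C))))
                   (trans (cong ⋃ (sym S≡)) (sym b≡))

  cone-step : (τ : OrderedPartition n) → InΩ c π τ →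
     Σ (OrderedPartition n) λ ρ →
       InΩ c π ρ × (apex π ≤face ρ) × (τ ≤face ρ) ×
       (∀ (w : OrderedPartition n) → IsVertex w → w ≤face ρ → (w ≡ apex π) ⊎ (w ≤face τ))
  cone-step (opart [] C) ((τ-part , _) , _ , not-top , _) = ⊥-elim (not-top (empty-front⇒top τ-part))
  cone-step τ@(opart (x ∷ xs) C) τ∈Ω@((τ-part , c≤τ) , _ , _ , π≤τ@(_ , Z⊆C)) with nonempty? (C ─ Z)
  ... | no C─Z=∅ =
    τ , τ∈Ω ,
    subst (λ K → opart [ ∁ K ] K ≤face τ) (empty-─⇒≡ C─Z=∅ Z⊆C) (complement-vertex-face (s≤s z≤n) τ-part) ,
    face-refl τ , λ _ _ w≤τ → inj₂ w≤τ
  ... | yes C─Z≠∅ =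
    split-off-Z (x ∷ xs) C ,
    InΩ-intro (ρ-part , split-type {x ∷ xs} Z⊆C C─Z≠∅ c≤τ) (λ ()) (split-above-π {x ∷ xs} π≤τ) ,
    complement-vertex-face (s≤s z≤n) ρ-part , split-face {x ∷ xs} Z⊆C , split-vertices {x ∷ xs} Z⊆C ρ-part
    where
    ρ-part : IsOrderedPartition (split-off-Z (x ∷ xs) C)
    ρ-part = split-ordered Z⊆C C─Z≠∅ τ-part

  -- The apex lies in Ω: Z ≠ [n] because π has a nonempty block besides Z, and c has a cut
  -- before its final run |Z|.
  apex-in-Ω : All Nonempty Bs → 1 ≤ length Bs → map ∣_∣ Bs ↭ ds → sum c ≡ n → InΩ c π (apex π)
  apex-in-Ω nonempty 1≤m type-Bs sum≡n =
    InΩ-intro (complement-pair (∁Z≠∅ Bs nonempty Z∩Bs=∅ 1≤m) ,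
               coarsening-into-two c ds 1≤length-ds c≤π (trans (∣∁p∣+∣p∣≡n Z) (sym sum≡n)))
      (λ ()) (All.map (λ Z∩B=∅ → inj₂ (here (λ {y} → disjoint⇒⊆∁ Z∩B=∅ {y}))) Z∩Bs=∅ , λ x∈Z → x∈Z)
    where
    ∁Z≠∅ : (Bs′ : List (Subset n)) → All Nonempty Bs′ → All (Disjoint Z) Bs′ → 1 ≤ length Bs′ → Nonempty (∁ Z)
    ∁Z≠∅ (B ∷ _) ((x , x∈B) ∷ _) (Z∩B=∅ ∷ _) _ = x , disjoint⇒⊆∁ Z∩B=∅ x∈B
    1≤length-ds : 1 ≤ length ds
    1≤length-ds = subst (1 ≤_) (trans (sym (length-map ∣_∣ Bs)) (↭-length type-Bs)) 1≤m

lemma5p2 : (n : ℕ) (c : List ℕ) → IsComposition n c →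
    (π : PointedPartition n) → InΠ c π → 1 ≤ length (blocks π) →
    IsConeWithApex (InΩ c π) (apex π)
lemma5p2 n c (_ , _ , sum≡n) (ppart Bs Z)
  ((nonempty , (Z∩Bs=∅ ∷ _) , _) , _ , c≤π , ds , _ , refl , type-Bs , refl) 1≤m =
  apex-in-Ω nonempty 1≤m type-Bs sum≡n , cone-step
  where open Cone c Bs Z Z∩Bs=∅ ds c≤π
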